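{- Let $k,\ell\geq 1$ and $G\in S_{k,\ell}$. Then every induced subdigraph $H$ of $G$ satisfies $H\in S_{k,\ell}$.
   Context: A set of sequences $Q$ consists of sequences of pairwise distinct items, each with a type. The sequence digraph $g(Q)$ has as vertex set the set of all types occurring in $Q$, and an arc $(u,v)$ iff $u\neq v$ and in some sequence an item of type $u$ occurs at a position strictly before an item of type $v$. $S_{k,\ell}$ is the class of all digraphs $g(Q)$ with $Q$ consisting of at most $k$ sequences and containing, summed over all sequences, at most $\ell$ items of each type. -}

module Defs where

open import Data.Nat using (ℕ; _≤_)
open import Data.Fin using (Fin; _<_)
open import Data.Fin.Properties using (_≟_)
open import Data.List using (List; length; lookup; concat; filter)
open import Data.List.Membership.Propositional using (_∈_)
open import Data.Product using (Σ; ∃; ∃-syntax; _×_)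
open import Relation.Binary.PropositionalEquality using (_≡_; _≢_)
open import Function.Definitions using (Injective)

record Digraph : Set₁ where
  field
    n   : ℕ
    Arc : Fin n → Fin n → Set
open Digraph public

_⟺_ : Set → Set → Set
A ⟺ B = (A → B) × (B → A)

-- A set of sequences whose types are vertices Fin n.  Items are abstracted
-- to their types (each list entry is one item, recorded by its type).
Seqs : ℕ → Set
Seqs n = List (List (Fin n))

Before : ∀ {n} → List (Fin n) → Fin n → Fin n → Set
Before s u v = ∃[ i ] ∃[ j ] (i < j × lookup s i ≡ u × lookup s j ≡ v)

count : ∀ {n} → Seqs n → Fin n → ℕ
count Q u = length (filter (_≟ u) (concat Q))

Occurs : ∀ {n} → Seqs n → Fin n → Set
Occurs Q u = ∃[ s ] (s ∈ Q × u ∈ s)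

IsSeqDigraph : (G : Digraph) → Seqs (n G) → Set
IsSeqDigraph G Q =
  (∀ u → Occurs Q u) ×
  (∀ u v → Arc G u v ⟺ (u ≢ v × ∃[ s ] (s ∈ Q × Before s u v)))

S : ℕ → ℕ → Digraph → Set
S k ℓ G = ∃[ Q ] (length Q ≤ k × (∀ u → count Q u ≤ ℓ) × IsSeqDigraph G Q)

-- H is (isomorphic to) an induced subdigraph of G: an injective vertex map
-- f preserving and reflecting arcs.
InducedSub : Digraph → Digraph → Set
InducedSub H G =
  Σ (Fin (n H) → Fin (n G)) λ f →
    Injective _≡_ _≡_ f × (∀ u v → Arc H u v ⟺ Arc G (f u) (f v))

-- Idea.  Let G = g(Q) and let f : V(H) → V(G) embed H as an induced
-- subdigraph.  Delete from every sequence of Q the items whose type is not in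
-- the image of f, and rename each remaining item f(u) to u.  The resulting
-- family Q' has as many sequences as Q, every type u of H occurs in Q'
-- exactly as often as f(u) occurs in Q, and u precedes v in a sequence of Q'
-- iff f(u) precedes f(v) in the corresponding sequence of Q.  Since f
-- reflects arcs, g(Q') = H, so H ∈ S_{k,ℓ}.
module Submission where

open import Defs
open import Data.Nat using (ℕ; _≥_; suc; z≤n; s≤s)
open import Data.Nat.Properties using (≤-trans; ≤-reflexive)
open import Data.Fin using (Fin; zero; suc)
open import Data.Fin.Properties using (_≟_; any?)
open import Data.Maybe using (Maybe; just; nothing)
open import Data.Maybe.Properties using (just-injective)
open import Data.List using (List; []; _∷_; _++_; map; concat; filter; length; mapMaybe)
open import Data.List.Properties using (length-map; mapMaybe-++)
open import Data.List.Relation.Unary.Any using (here; there; index)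
open import Data.List.Relation.Unary.Any.Properties using (lookup-index)
open import Data.List.Membership.Propositional using (_∈_)
open import Data.List.Membership.Propositional.Properties using (∈-map⁺; ∈-map⁻; ∈-lookup)
open import Data.Product using (∃-syntax; _×_; _,_)
open import Data.Empty using (⊥-elim)
open import Relation.Nullary using (yes; no)
open import Relation.Binary.Definitions using (DecidableEquality)
open import Relation.Binary.PropositionalEquality
open import Function.Definitions using (Injective)

data Precedes {A : Set} : List A → A → A → Set where
  first : ∀ {u v xs} → v ∈ xs → Precedes (u ∷ xs) u v
  later : ∀ {x u v xs} → Precedes xs u v → Precedes (x ∷ xs) u v

before⇒precedes : ∀ {n} (s : List (Fin n)) {u v} → Before s u v → Precedes s u v
before⇒precedes []      (() , _)
before⇒precedes (_ ∷ _) (zero  , zero  , () , _)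
before⇒precedes (_ ∷ _) (zero  , suc j , _ , refl , refl) = first (∈-lookup j)
before⇒precedes (_ ∷ _) (suc i , zero  , () , _)
before⇒precedes (_ ∷ s) (suc i , suc j , s≤s i<j , eu , ev) =
  later (before⇒precedes s (i , j , i<j , eu , ev))

precedes⇒before : ∀ {n} {s : List (Fin n)} {u v} → Precedes s u v → Before s u v
precedes⇒before (first v∈s) = zero , suc (index v∈s) , s≤s z≤n , refl , sym (lookup-index v∈s)
precedes⇒before (later p) with precedes⇒before p
... | i , j , i<j , eu , ev = suc i , suc j , s≤s i<j , eu , ev

-- Restriction of lists along a map f : A → B with partial inverse g:
-- 'restrict' keeps the entries in the image of f and renames f x to x.
-- Note that 'complete' forces f to be injective.
module Restriction {A B : Set} (f : A → B) (g : B → Maybe A)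
                   (sound : ∀ {x y} → g y ≡ just x → f x ≡ y)
                   (complete : ∀ x → g (f x) ≡ just x) where

  restrict : List B → List A
  restrict = mapMaybe g

  restrict-concat : (xss : List (List B)) → concat (map restrict xss) ≡ restrict (concat xss)
  restrict-concat []         = refl
  restrict-concat (xs ∷ xss) = begin
    restrict xs ++ concat (map restrict xss) ≡⟨ cong (restrict xs ++_) (restrict-concat xss) ⟩
    restrict xs ++ restrict (concat xss)     ≡⟨ mapMaybe-++ g xs (concat xss) ⟨
    restrict (xs ++ concat xss)              ∎
    where open ≡-Reasoning

  ∈-restrict⁺ : ∀ {u} (xs : List B) → f u ∈ xs → u ∈ restrict xs
  ∈-restrict⁺ {u} (x ∷ xs) (here refl) rewrite complete u = here refl
  ∈-restrict⁺ (x ∷ xs) (there p) with g x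
  ... | just _  = there (∈-restrict⁺ xs p)
  ... | nothing = ∈-restrict⁺ xs p

  ∈-restrict⁻ : ∀ {u} (xs : List B) → u ∈ restrict xs → f u ∈ xs
  ∈-restrict⁻ (x ∷ xs) p with g x in eq | p
  ... | just _  | here refl = here (sound eq)
  ... | just _  | there q   = there (∈-restrict⁻ xs q)
  ... | nothing | q         = there (∈-restrict⁻ xs q)

  precedes-restrict⁺ : ∀ {u v} (xs : List B) → Precedes xs (f u) (f v) → Precedes (restrict xs) u v
  precedes-restrict⁺ {u} (x ∷ xs) (first p) rewrite complete u = first (∈-restrict⁺ xs p)
  precedes-restrict⁺ (x ∷ xs) (later p) with g x
  ... | just _  = later (precedes-restrict⁺ xs p)
  ... | nothing = precedes-restrict⁺ xs p

  precedes-restrict⁻ : ∀ {u v} (xs : List B) → Precedes (restrict xs) u v → Precedes xs (f u) (f v)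
  precedes-restrict⁻ (x ∷ xs) p with g x in eq | p
  ... | just _  | first q with refl ← sound eq = first (∈-restrict⁻ xs q)
  ... | just _  | later q = later (precedes-restrict⁻ xs q)
  ... | nothing | q       = later (precedes-restrict⁻ xs q)

  count-restrict : (_≟ᴬ_ : DecidableEquality A) (_≟ᴮ_ : DecidableEquality B) (xs : List B) (u : A) →
                   length (filter (_≟ᴬ u) (restrict xs)) ≡ length (filter (_≟ᴮ f u) xs)
  count-restrict _≟ᴬ_ _≟ᴮ_ []       u = refl
  count-restrict _≟ᴬ_ _≟ᴮ_ (x ∷ xs) u with g x in eq
  ... | just w with w ≟ᴬ u | x ≟ᴮ f u
  ...   | yes _   | yes _    = cong suc (count-restrict _≟ᴬ_ _≟ᴮ_ xs u)
  ...   | yes w≡u | no x≢fu  = ⊥-elim (x≢fu (trans (sym (sound eq)) (cong f w≡u)))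
  ...   | no w≢u  | yes refl = ⊥-elim (w≢u (just-injective (trans (sym eq) (complete u))))
  ...   | no _    | no _     = count-restrict _≟ᴬ_ _≟ᴮ_ xs u
  count-restrict _≟ᴬ_ _≟ᴮ_ (x ∷ xs) u | nothing with x ≟ᴮ f u
  ...   | yes refl with () ← trans (sym eq) (complete u)
  ...   | no _     = count-restrict _≟ᴬ_ _≟ᴮ_ xs u

module _ {a b : ℕ} (f : Fin a → Fin b) where

  preimage : Fin b → Maybe (Fin a)
  preimage y with any? (λ x → f x ≟ y)
  ... | yes (x , _) = just x
  ... | no _        = nothing

  preimage-sound : ∀ {x y} → preimage y ≡ just x → f x ≡ y
  preimage-sound {y = y} eq with any? (λ x → f x ≟ y)
  preimage-sound refl | yes (_ , fx≡y) = fx≡y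
  preimage-sound ()   | no _

  preimage-complete : Injective _≡_ _≡_ f → ∀ x → preimage (f x) ≡ just x
  preimage-complete inj x with any? (λ x′ → f x′ ≟ f x)
  ... | yes (x′ , fx′≡fx) = cong just (inj fx′≡fx)
  ... | no ∄x′            = ⊥-elim (∄x′ (x , refl))

module RestrictSeqs {a b : ℕ} (f : Fin a → Fin b) (f-inj : Injective _≡_ _≡_ f) (Q : Seqs b) where

  open Restriction f (preimage f) (preimage-sound f) (preimage-complete f f-inj)

  Q′ : Seqs a
  Q′ = map restrict Q

  length-Q′ : length Q′ ≡ length Q
  length-Q′ = length-map restrict Q

  count-Q′ : ∀ u → count Q′ u ≡ count Q (f u)
  count-Q′ u = trans (cong (λ xs → length (filter (_≟ u) xs)) (restrict-concat Q))
                     (count-restrict _≟_ _≟_ (concat Q) u)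

  occurs-Q′ : ∀ {u} → Occurs Q (f u) → Occurs Q′ u
  occurs-Q′ (s , s∈Q , fu∈s) = restrict s , ∈-map⁺ restrict s∈Q , ∈-restrict⁺ s fu∈s

  ordered-Q′ : ∀ u v → (∃[ s ] (s ∈ Q × Before s (f u) (f v))) ⟺ (∃[ s ] (s ∈ Q′ × Before s u v))
  ordered-Q′ u v = to , from
    where
    to : ∃[ s ] (s ∈ Q × Before s (f u) (f v)) → ∃[ s ] (s ∈ Q′ × Before s u v)
    to (s , s∈Q , before) =
      restrict s , ∈-map⁺ restrict s∈Q , precedes⇒before (precedes-restrict⁺ s (before⇒precedes s before))

    from : ∃[ s ] (s ∈ Q′ × Before s u v) → ∃[ s ] (s ∈ Q × Before s (f u) (f v))
    from (s′ , s′∈Q′ , before) with ∈-map⁻ restrict s′∈Q′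
    ... | s , s∈Q , refl =
      s , s∈Q , precedes⇒before (precedes-restrict⁻ s (before⇒precedes (restrict s) before))

_⟺∘_ : ∀ {P R T : Set} → P ⟺ R → R ⟺ T → P ⟺ T
(p→r , r→p) ⟺∘ (r→t , t→r) = (λ p → r→t (p→r p)) , (λ t → r→p (t→r t))

_×⟺_ : ∀ {P P′ R R′ : Set} → P ⟺ P′ → R ⟺ R′ → (P × R) ⟺ (P′ × R′)
(p→p′ , p′→p) ×⟺ (r→r′ , r′→r) = (λ (p , r) → p→p′ p , r→r′ r) , (λ (p′ , r′) → p′→p p′ , r′→r r′)

≢-injective : ∀ {A B : Set} {f : A → B} → Injective _≡_ _≡_ f → ∀ {u v} → (f u ≢ f v) ⟺ (u ≢ v)
≢-injective {f = f} f-inj = (λ fu≢fv u≡v → fu≢fv (cong f u≡v)) , (λ u≢v fu≡fv → u≢v (f-inj fu≡fv))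

proposition4p10 : (k ℓ : ℕ) → k ≥ 1 → ℓ ≥ 1 → (G H : Digraph) →
                    S k ℓ G → InducedSub H G → S k ℓ H
proposition4p10 k ℓ _ _ G H (Q , |Q|≤k , count≤ℓ , occurs , arcs) (f , f-inj , f-induced) =
  Q′ ,
  ≤-trans (≤-reflexive length-Q′) |Q|≤k ,
  (λ u → ≤-trans (≤-reflexive (count-Q′ u)) (count≤ℓ (f u))) ,
  (λ u → occurs-Q′ (occurs (f u))) ,
  arcs′
  where
  open RestrictSeqs f f-inj Q

  -- H-arcs are G-arcs between images, i.e. precedences in Q, i.e. in Q′.
  arcs′ : ∀ u v → Arc H u v ⟺ (u ≢ v × ∃[ s ] (s ∈ Q′ × Before s u v))
  arcs′ u v = f-induced u v ⟺∘ (arcs (f u) (f v) ⟺∘ (≢-injective f-inj ×⟺ ordered-Q′ u v))
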